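{- Let $\mathcal H$ be a 3-graph on $n$ vertices with $4\mid n$ satisfying \[ \delta_1(\mathcal H)\ge \binom{n-1}{2}-\binom{\frac34 n}{2}+\frac38 n+c(n), \] where $c(n)=1$ if $8\mid n$ and $c(n)=-\tfrac12$ otherwise. If $S\subseteq V(\mathcal H)$ is such that the induced subgraph $\mathcal H[S]$ contains no copy of $\mathcal C_4^3$, then $|S|\le\frac34 n$.
   Context: A 3-graph consists of a vertex set $V$ and an edge set $E\subseteq\binom V3$; $\delta_1(\mathcal H)$ is the minimum over vertices $v$ of the number of edges containing $v$. $\mathcal C_4^3$ denotes the (unique up to isomorphism) 3-graph on four vertices with exactly two edges. -}

module Defs where

open import Data.Nat using (ℕ; zero; suc; _+_; _*_)
open import Data.Bool using (Bool; true; false; _∧_)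
open import Data.List using (List; []; _∷_; map; _++_; filterᵇ; length)
open import Data.Vec using (Vec; []; _∷_; lookup)
open import Data.Fin using (Fin)
open import Data.Fin.Subset using (Subset; ∣_∣; _∈_; _∪_; ⁅_⁆)
open import Data.Product using (Σ; _×_; ∃-syntax)
open import Relation.Binary.PropositionalEquality using (_≡_; _≢_)

record ThreeGraph (n : ℕ) : Set where
  field
    edge    : Subset n → Bool
    uniform : ∀ s → edge s ≡ true → ∣ s ∣ ≡ 3
open ThreeGraph public

allSubsets : (n : ℕ) → List (Subset n)
allSubsets zero    = [] ∷ []
allSubsets (suc n) = map (true ∷_) (allSubsets n) ++ map (false ∷_) (allSubsets n)

degree : ∀ {n} → ThreeGraph n → Fin n → ℕ
degree H v = length (filterᵇ (λ s → edge H s ∧ lookup s v) (allSubsets _))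

triple : ∀ {n} → Fin n → Fin n → Fin n → Subset n
triple a b c = ⁅ a ⁆ ∪ ⁅ b ⁆ ∪ ⁅ c ⁆

IsEdge : ∀ {n} → ThreeGraph n → Subset n → Set
IsEdge H s = edge H s ≡ true

-- H[S] contains a copy of C_4^3 (two edges on four vertices): four distinct
-- vertices a b c d of S with {a,b,c} and {a,b,d} both edges of H.
HasC43In : ∀ {n} → ThreeGraph n → Subset n → Set
HasC43In {n} H S =
  ∃[ a ] ∃[ b ] ∃[ c ] ∃[ d ]
    ( (a ∈ S × b ∈ S × c ∈ S × d ∈ S)
    × (a ≢ b × a ≢ c × a ≢ d × b ≢ c × b ≢ d × c ≢ d)
    × IsEdge H (triple a b c) × IsEdge H (triple a b d))

module Submission where

open import Defs
open import Data.Nat using (ℕ; zero; suc; _+_; _*_; _∸_; _≤_; _<_; z≤n; s≤s; _≡ᵇ_; _≤?_)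
open import Data.Nat.Properties
open import Data.Nat.Divisibility using (_∣_; divides; ∣m+n∣m⇒∣n; ∣⇒≤)
open import Data.Nat.Combinatorics using (_C_; nC1≡n; nCk+nC[k+1]≡[n+1]C[k+1])
open import Data.Nat.Tactic.RingSolver using (solve-∀)
open import Algebra.Properties.CommutativeSemigroup +-commutativeSemigroup using (interchange)
open import Data.Bool using (Bool; true; false; _∧_; _∨_; not)
open import Data.Bool.Properties using (∧-zeroʳ; ∧-identityʳ; ∧-conicalˡ; ∧-conicalʳ; not-injective)
open import Data.List using (List; []; _∷_; map; _++_; filterᵇ; length)
open import Data.Vec using (Vec; []; _∷_; lookup) renaming (map to vmap)
open import Data.Vec.Properties using (lookup-replicate; lookup-zipWith; tabulate∘lookup; tabulate-cong; lookup⇒[]=; ∷-injectiveʳ)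
open import Data.Fin using (Fin; zero; suc)
open import Data.Fin.Subset using (Subset; ∣_∣; _∈_; ⁅_⁆; _∪_)
open import Data.Product using (∃-syntax; _×_; _,_; proj₁; proj₂)
open import Data.Sum using (_⊎_; inj₁; inj₂)
open import Data.Empty using (⊥; ⊥-elim)
open import Function using (_∘_)
open import Relation.Nullary using (¬_; yes; no; contradiction)
open import Relation.Binary.PropositionalEquality

-- Fact 4.1.  Let n = 4k, let S be a set of vertices with H[S] free of C₄³,
-- and suppose |S| > 3k; we contradict the minimum degree condition.
--
-- Fix v ∈ S and write |S| = a + 1, so a ≥ 3k.  Every pair of vertices
-- not both in S∖{v} may span an edge with v, which gives the link bound
--     deg(v) ≤ C(n-1,2) - C(a,2) + deg_S(v),
-- proved by counting 3-sets through v by how they meet S∖{v} and V∖S.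
-- C₄³-freeness makes the link of v inside S a matching, so 2·deg_S(v) ≤ a.
-- If 8 ∣ n these two bounds already contradict the degree condition.  If
-- 8 ∤ n they force a = 3k and deg_S(v) = (3k-1)/2 = 3j+1 (k = 2j+1) for
-- every v ∈ S; the handshake lemma then gives 3·e(H[S]) = (3j+1)(6j+4),
-- which is 1 modulo 3, a contradiction.

⟦_⟧ : Bool → ℕ
⟦ true ⟧ = 1
⟦ false ⟧ = 0

count : {A : Set} → (A → Bool) → List A → ℕ
count p [] = 0
count p (x ∷ xs) = ⟦ p x ⟧ + count p xs

module _ {A : Set} where

  length-filterᵇ : (p : A → Bool) (xs : List A) → length (filterᵇ p xs) ≡ count p xs
  length-filterᵇ p [] = refl
  length-filterᵇ p (x ∷ xs) with p x
  ... | true = cong suc (length-filterᵇ p xs)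
  ... | false = length-filterᵇ p xs

  count-none : (p : A → Bool) → (∀ x → p x ≡ false) → (xs : List A) → count p xs ≡ 0
  count-none p none [] = refl
  count-none p none (x ∷ xs) rewrite none x = count-none p none xs

  count-∨ : (p q r : A → Bool) → (∀ x → p x ≡ true → (q x ∨ r x) ≡ true) →
    (xs : List A) → count p xs ≤ count q xs + count r xs
  count-∨ p q r cover [] = z≤n
  count-∨ p q r cover (x ∷ xs) = begin
    ⟦ p x ⟧ + count p xs
      ≤⟨ +-mono-≤ (indicator-∨ (p x) (q x) (r x) (cover x)) (count-∨ p q r cover xs) ⟩
    (⟦ q x ⟧ + ⟦ r x ⟧) + (count q xs + count r xs)
      ≡⟨ interchange ⟦ q x ⟧ ⟦ r x ⟧ (count q xs) (count r xs) ⟩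
    (⟦ q x ⟧ + count q xs) + (⟦ r x ⟧ + count r xs) ∎
    where
    open ≤-Reasoning
    indicator-∨ : ∀ a b c → (a ≡ true → (b ∨ c) ≡ true) → ⟦ a ⟧ ≤ ⟦ b ⟧ + ⟦ c ⟧
    indicator-∨ false b c _ = z≤n
    indicator-∨ true true c _ = s≤s z≤n
    indicator-∨ true false true _ = s≤s z≤n
    indicator-∨ true false false imp with imp refl
    ... | ()

  count-witness : (p : A → Bool) (xs : List A) → 1 ≤ count p xs → ∃[ x ] p x ≡ true
  count-witness p (x ∷ xs) pos with p x in px
  ... | true = x , px
  ... | false = count-witness p xs pos

count-allSubsets-suc : ∀ {n} (p : Subset (suc n) → Bool) →
  count p (allSubsets (suc n)) ≡
    count (p ∘ (true ∷_)) (allSubsets n) + count (p ∘ (false ∷_)) (allSubsets n)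
count-allSubsets-suc {n} p = trans (count-++ (map (true ∷_) (allSubsets n)) _)
  (cong₂ _+_ (count-map (true ∷_) (allSubsets n)) (count-map (false ∷_) (allSubsets n)))
  where
  count-++ : ∀ xs ys → count p (xs ++ ys) ≡ count p xs + count p ys
  count-++ [] ys = refl
  count-++ (x ∷ xs) ys = trans (cong (⟦ p x ⟧ +_) (count-++ xs ys)) (sym (+-assoc ⟦ p x ⟧ _ _))
  count-map : ∀ f xs → count p (map f xs) ≡ count (p ∘ f) xs
  count-map f [] = refl
  count-map f (x ∷ xs) = cong (⟦ p (f x) ⟧ +_) (count-map f xs)

count-at-most-one : ∀ n (p : Subset n → Bool) →
  (∀ s t → p s ≡ true → p t ≡ true → s ≡ t) → count p (allSubsets n) ≤ 1
count-at-most-one zero p unique with p []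
... | true = s≤s z≤n
... | false = z≤n
count-at-most-one (suc n) p unique =
  subst (_≤ 1) (sym (count-allSubsets-suc p)) (halves _ _ refl refl)
  where
  L = allSubsets n
  half≤1 : ∀ b → count (p ∘ (b ∷_)) L ≤ 1
  half≤1 b = count-at-most-one n (p ∘ (b ∷_)) (λ s t ps pt → ∷-injectiveʳ (unique _ _ ps pt))
  -- Witnesses in both halves would be two different witnesses of p.
  halves : ∀ a b → count (p ∘ (true ∷_)) L ≡ a → count (p ∘ (false ∷_)) L ≡ b → a + b ≤ 1
  halves zero b _ out-count = subst (_≤ 1) out-count (half≤1 false)
  halves (suc a) zero in-count _ = subst (_≤ 1) (trans in-count (sym (+-identityʳ _))) (half≤1 true)
  halves (suc a) (suc b) in-count out-count
    with count-witness (p ∘ (true ∷_)) L (subst (1 ≤_) (sym in-count) (s≤s z≤n))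
       | count-witness (p ∘ (false ∷_)) L (subst (1 ≤_) (sym out-count) (s≤s z≤n))
  ... | s , ps | t , pt with unique _ _ ps pt
  ... | ()

∑ : (n : ℕ) → (Fin n → ℕ) → ℕ
∑ zero f = 0
∑ (suc n) f = f zero + ∑ n (f ∘ suc)

∑-cong : ∀ n {f g : Fin n → ℕ} → (∀ i → f i ≡ g i) → ∑ n f ≡ ∑ n g
∑-cong zero f≗g = refl
∑-cong (suc n) f≗g = cong₂ _+_ (f≗g zero) (∑-cong n (f≗g ∘ suc))

∑-mono : ∀ n {f g : Fin n → ℕ} → (∀ i → f i ≤ g i) → ∑ n f ≤ ∑ n g
∑-mono zero f≤g = z≤n
∑-mono (suc n) f≤g = +-mono-≤ (f≤g zero) (∑-mono n (f≤g ∘ suc))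

∑-zero : ∀ n → ∑ n (λ _ → 0) ≡ 0
∑-zero zero = refl
∑-zero (suc n) = ∑-zero n

∑-+ : ∀ n (f g : Fin n → ℕ) → ∑ n (λ i → f i + g i) ≡ ∑ n f + ∑ n g
∑-+ zero f g = refl
∑-+ (suc n) f g = trans (cong (f zero + g zero +_) (∑-+ n (f ∘ suc) (g ∘ suc)))
                        (interchange (f zero) (g zero) _ _)

∑-*ˡ : ∀ n c (f : Fin n → ℕ) → ∑ n (λ i → c * f i) ≡ c * ∑ n f
∑-*ˡ zero c f = sym (*-zeroʳ c)
∑-*ˡ (suc n) c f = trans (cong (c * f zero +_) (∑-*ˡ n c (f ∘ suc)))
                         (sym (*-distribˡ-+ c (f zero) _))

double-count : ∀ {A : Set} n (q : A → Bool) (w : Fin n → A → Bool) (c : ℕ) →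
  (∀ x → q x ≡ true → ∑ n (λ i → ⟦ w i x ⟧) ≡ c) →
  (xs : List A) → ∑ n (λ i → count (λ x → q x ∧ w i x) xs) ≡ count q xs * c
double-count n q w c degree-c [] = ∑-zero n
double-count n q w c degree-c (x ∷ xs) = begin
  ∑ n (λ i → ⟦ q x ∧ w i x ⟧ + count (λ y → q y ∧ w i y) xs)
    ≡⟨ ∑-+ n _ _ ⟩
  ∑ n (λ i → ⟦ q x ∧ w i x ⟧) + ∑ n (λ i → count (λ y → q y ∧ w i y) xs)
    ≡⟨ cong₂ _+_ column (double-count n q w c degree-c xs) ⟩
  ⟦ q x ⟧ * c + count q xs * c
    ≡⟨ sym (*-distribʳ-+ c ⟦ q x ⟧ (count q xs)) ⟩
  (⟦ q x ⟧ + count q xs) * c ∎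
  where
  open ≡-Reasoning
  column : ∑ n (λ i → ⟦ q x ∧ w i x ⟧) ≡ ⟦ q x ⟧ * c
  column with q x in qx
  ... | true = trans (degree-c x qx) (sym (+-identityʳ c))
  ... | false = ∑-zero n

_==_ : ∀ {n} → Fin n → Fin n → Bool
zero == zero = true
zero == suc j = false
suc i == zero = false
suc i == suc j = i == j

==-refl : ∀ {n} (i : Fin n) → (i == i) ≡ true
==-refl zero = refl
==-refl (suc i) = ==-refl i

==⇒≡ : ∀ {n} {i j : Fin n} → (i == j) ≡ true → i ≡ j
==⇒≡ {i = zero} {zero} _ = refl
==⇒≡ {i = suc i} {suc j} eq = cong suc (==⇒≡ eq)

==-false⇒≢ : ∀ {n} {i j : Fin n} → (i == j) ≡ false → i ≢ j
==-false⇒≢ {i = i} i≠j refl with trans (sym i≠j) (==-refl i)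
... | ()

∑-point : ∀ {n} (v : Fin n) → ∑ n (λ i → ⟦ i == v ⟧) ≡ 1
∑-point {suc n} zero = cong suc (∑-zero n)
∑-point {suc n} (suc v) = ∑-point v

∑-remove-point : ∀ {n} (f : Fin n → Bool) (v : Fin n) → f v ≡ true →
  ∑ n (λ i → ⟦ f i ∧ not (i == v) ⟧) + 1 ≡ ∑ n (λ i → ⟦ f i ⟧)
∑-remove-point {n} f v fv = begin
  ∑ n (λ i → ⟦ f i ∧ not (i == v) ⟧) + 1
    ≡⟨ cong (∑ n (λ i → ⟦ f i ∧ not (i == v) ⟧) +_) (sym (∑-point v)) ⟩
  ∑ n (λ i → ⟦ f i ∧ not (i == v) ⟧) + ∑ n (λ i → ⟦ i == v ⟧)
    ≡⟨ sym (∑-+ n _ _) ⟩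
  ∑ n (λ i → ⟦ f i ∧ not (i == v) ⟧ + ⟦ i == v ⟧)
    ≡⟨ ∑-cong n pointwise ⟩
  ∑ n (λ i → ⟦ f i ⟧) ∎
  where
  open ≡-Reasoning
  pointwise : ∀ i → ⟦ f i ∧ not (i == v) ⟧ + ⟦ i == v ⟧ ≡ ⟦ f i ⟧
  pointwise i = split (f i) (i == v) (λ i=v → subst (λ j → f j ≡ true) (sym (==⇒≡ i=v)) fv)
    where
    split : ∀ x b → (b ≡ true → x ≡ true) → ⟦ x ∧ not b ⟧ + ⟦ b ⟧ ≡ ⟦ x ⟧
    split x false _ rewrite ∧-identityʳ x = +-identityʳ ⟦ x ⟧
    split x true b⇒x rewrite b⇒x refl = refl

∑-one⇒point : ∀ n (f : Fin n → Bool) → ∑ n (λ i → ⟦ f i ⟧) ≡ 1 →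
  ∃[ c ] (∀ i → f i ≡ (i == c))
∑-one⇒point (suc n) f sum≡1 with f zero in f0
... | true = zero , pointwise
  where
  rest-false : ∀ m (g : Fin m → Bool) → ∑ m (λ i → ⟦ g i ⟧) ≡ 0 → ∀ i → g i ≡ false
  rest-false (suc m) g sum≡0 zero with g zero
  ... | false = refl
  rest-false (suc m) g sum≡0 (suc i) with g zero
  ... | false = rest-false m (g ∘ suc) sum≡0 i
  pointwise : ∀ i → f i ≡ (i == zero)
  pointwise zero = f0
  pointwise (suc i) = rest-false n (f ∘ suc) (suc-injective sum≡1) i
... | false with ∑-one⇒point n (f ∘ suc) sum≡1
... | c , pointwise′ = suc c , pointwise
  where
  pointwise : ∀ i → f i ≡ (i == suc c)
  pointwise zero = f0
  pointwise (suc i) = pointwise′ i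

size-as-sum : ∀ {n} (p : Subset n) → ∣ p ∣ ≡ ∑ n (λ i → ⟦ lookup p i ⟧)
size-as-sum [] = refl
size-as-sum (true ∷ p) = cong suc (size-as-sum p)
size-as-sum (false ∷ p) = size-as-sum p

member-of-nonempty : ∀ {n a} (p : Subset n) → ∣ p ∣ ≡ suc a → ∃[ v ] lookup p v ≡ true
member-of-nonempty (true ∷ p) _ = zero , refl
member-of-nonempty (false ∷ p) size with member-of-nonempty p size
... | v , pv = suc v , pv

subset-ext : ∀ {n} (p q : Subset n) → (∀ i → lookup p i ≡ lookup q i) → p ≡ q
subset-ext p q p≗q =
  trans (sym (tabulate∘lookup p)) (trans (tabulate-cong p≗q) (tabulate∘lookup q))

lookup-⁅⁆ : ∀ {n} (a i : Fin n) → lookup ⁅ a ⁆ i ≡ (i == a)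
lookup-⁅⁆ zero zero = refl
lookup-⁅⁆ zero (suc i) = lookup-replicate i false
lookup-⁅⁆ (suc a) zero = refl
lookup-⁅⁆ (suc a) (suc i) = lookup-⁅⁆ a i

lookup-triple : ∀ {n} (a b c i : Fin n) →
  lookup (triple a b c) i ≡ (i == a) ∨ ((i == b) ∨ (i == c))
lookup-triple a b c i = begin
  lookup (⁅ a ⁆ ∪ (⁅ b ⁆ ∪ ⁅ c ⁆)) i
    ≡⟨ lookup-zipWith _∨_ i ⁅ a ⁆ (⁅ b ⁆ ∪ ⁅ c ⁆) ⟩
  lookup ⁅ a ⁆ i ∨ lookup (⁅ b ⁆ ∪ ⁅ c ⁆) i
    ≡⟨ cong₂ _∨_ (lookup-⁅⁆ a i) (lookup-zipWith _∨_ i ⁅ b ⁆ ⁅ c ⁆) ⟩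
  (i == a) ∨ (lookup ⁅ b ⁆ i ∨ lookup ⁅ c ⁆ i)
    ≡⟨ cong ((i == a) ∨_) (cong₂ _∨_ (lookup-⁅⁆ b i) (lookup-⁅⁆ c i)) ⟩
  (i == a) ∨ ((i == b) ∨ (i == c)) ∎
  where open ≡-Reasoning

_⊆ᵇ_ : ∀ {n} → Subset n → Subset n → Bool
[] ⊆ᵇ [] = true
(true ∷ e) ⊆ᵇ (true ∷ S) = e ⊆ᵇ S
(true ∷ e) ⊆ᵇ (false ∷ S) = false
(false ∷ e) ⊆ᵇ (_ ∷ S) = e ⊆ᵇ S

⊆ᵇ-lookup : ∀ {n} (e S : Subset n) → (e ⊆ᵇ S) ≡ true → ∀ i → lookup e i ≡ true → lookup S i ≡ true
⊆ᵇ-lookup (true ∷ e) (true ∷ S) e⊆S zero _ = refl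
⊆ᵇ-lookup (true ∷ e) (true ∷ S) e⊆S (suc i) ei = ⊆ᵇ-lookup e S e⊆S i ei
⊆ᵇ-lookup (false ∷ e) (_ ∷ S) e⊆S (suc i) ei = ⊆ᵇ-lookup e S e⊆S i ei

third-vertex : ∀ {n} (e : Subset n) {v u : Fin n} → ∣ e ∣ ≡ 3 →
  lookup e v ≡ true → lookup e u ≡ true → (u == v) ≡ false →
  ∃[ c ] (lookup e c ≡ true) × ((c == v) ≡ false) × ((c == u) ≡ false) × (e ≡ triple v u c)
third-vertex {n} e {v} {u} size≡3 ev eu u≠v =
  c , e-c , c≠v , c≠u , subset-ext e (triple v u c) pointwise
  where
  open ≡-Reasoning
  others rest : Fin n → Bool
  others i = lookup e i ∧ not (i == v)
  rest i = others i ∧ not (i == u)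

  others-u : others u ≡ true
  others-u rewrite eu | u≠v = refl

  rest-size : ∑ n (λ i → ⟦ rest i ⟧) + 1 + 1 ≡ 3
  rest-size = begin
    ∑ n (λ i → ⟦ rest i ⟧) + 1 + 1     ≡⟨ cong (_+ 1) (∑-remove-point others u others-u) ⟩
    ∑ n (λ i → ⟦ others i ⟧) + 1       ≡⟨ ∑-remove-point (lookup e) v ev ⟩
    ∑ n (λ i → ⟦ lookup e i ⟧)         ≡⟨ sym (size-as-sum e) ⟩
    ∣ e ∣                              ≡⟨ size≡3 ⟩
    3                                  ∎

  rest-is-point : ∃[ c ] (∀ i → rest i ≡ (i == c))
  rest-is-point = ∑-one⇒point n rest (+-cancelʳ-≡ 1 _ _ (+-cancelʳ-≡ 1 _ _ rest-size))

  c : Fin n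
  c = proj₁ rest-is-point

  rest-c : rest c ≡ true
  rest-c = trans (proj₂ rest-is-point c) (==-refl c)

  others-c : others c ≡ true
  others-c = ∧-conicalˡ _ _ rest-c

  e-c : lookup e c ≡ true
  e-c = ∧-conicalˡ _ _ others-c
  c≠v : (c == v) ≡ false
  c≠v = not-injective (∧-conicalʳ (lookup e c) _ others-c)
  c≠u : (c == u) ≡ false
  c≠u = not-injective (∧-conicalʳ (others c) _ rest-c)

  restore : ∀ x p q → (p ≡ true → x ≡ true) → (q ≡ true → x ≡ true) →
    x ≡ p ∨ (q ∨ ((x ∧ not p) ∧ not q))
  restore x true q p⇒x _ = p⇒x refl
  restore x false true _ q⇒x = q⇒x refl
  restore x false false _ _ rewrite ∧-identityʳ x | ∧-identityʳ x = refl

  at : ∀ {w} → lookup e w ≡ true → ∀ i → (i == w) ≡ true → lookup e i ≡ true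
  at {w} ew i i=w = subst (λ j → lookup e j ≡ true) (sym (==⇒≡ i=w)) ew

  pointwise : ∀ i → lookup e i ≡ lookup (triple v u c) i
  pointwise i = begin
    lookup e i                           ≡⟨ restore (lookup e i) (i == v) (i == u) (at ev i) (at eu i) ⟩
    (i == v) ∨ ((i == u) ∨ rest i)       ≡⟨ cong (λ b → (i == v) ∨ ((i == u) ∨ b)) (proj₂ rest-is-point i) ⟩
    (i == v) ∨ ((i == u) ∨ (i == c))     ≡⟨ sym (lookup-triple v u c i) ⟩
    lookup (triple v u c) i              ∎

data Colour : Set where
  c₀ c₁ c₂ : Colour

_==ᶜ_ : Colour → Colour → Bool
c₀ ==ᶜ c₀ = true
c₁ ==ᶜ c₁ = true
c₂ ==ᶜ c₂ = true
_ ==ᶜ _ = false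

classSize : ∀ {n} → Colour → Vec Colour n → ℕ
classSize x [] = 0
classSize x (y ∷ col) = ⟦ y ==ᶜ x ⟧ + classSize x col

meet : ∀ {n} → Colour → Vec Colour n → Subset n → ℕ
meet x [] [] = 0
meet x (y ∷ col) (true ∷ e) = ⟦ y ==ᶜ x ⟧ + meet x col e
meet x (y ∷ col) (false ∷ e) = meet x col e

meet-total : ∀ {n} (col : Vec Colour n) (e : Subset n) →
  meet c₀ col e + meet c₁ col e + meet c₂ col e ≡ ∣ e ∣
meet-total [] [] = refl
meet-total (_ ∷ col) (false ∷ e) = meet-total col e
meet-total (c₀ ∷ col) (true ∷ e) = cong suc (meet-total col e)
meet-total (c₁ ∷ col) (true ∷ e) =
  trans (cong (_+ meet c₂ col e) (+-suc (meet c₀ col e) _)) (cong suc (meet-total col e))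
meet-total (c₂ ∷ col) (true ∷ e) = trans (+-suc _ _) (cong suc (meet-total col e))

hasProfile : ∀ {n} → Vec Colour n → ℕ → ℕ → ℕ → Subset n → Bool
hasProfile col a b c e = (meet c₀ col e ≡ᵇ a) ∧ ((meet c₁ col e ≡ᵇ b) ∧ (meet c₂ col e ≡ᵇ c))

count-without-first : ∀ {n} (p : Subset (suc n) → Bool) → (∀ e → p (true ∷ e) ≡ false) →
  count p (allSubsets (suc n)) ≡ count (p ∘ (false ∷_)) (allSubsets n)
count-without-first {n} p none = trans (count-allSubsets-suc p)
  (cong (_+ count (p ∘ (false ∷_)) (allSubsets n)) (count-none (p ∘ (true ∷_)) none (allSubsets n)))

-- Split on the first vertex: if its colour is still needed,
-- Pascal's rule combines the two halves; otherwise only one half counts.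
profile-count : ∀ {n} (col : Vec Colour n) a b c →
  count (hasProfile col a b c) (allSubsets n) ≡
    (classSize c₀ col C a) * (classSize c₁ col C b) * (classSize c₂ col C c)
profile-count [] zero zero zero = refl
profile-count [] (suc a) b c = refl
profile-count [] zero (suc b) c = refl
profile-count [] zero zero (suc c) = refl
profile-count (c₀ ∷ col) zero b c =
  trans (count-without-first (hasProfile (c₀ ∷ col) zero b c) (λ _ → refl)) (profile-count col zero b c)
profile-count (c₁ ∷ col) a zero c =
  trans (count-without-first (hasProfile (c₁ ∷ col) a zero c) (λ e → ∧-zeroʳ (meet c₀ col e ≡ᵇ a))) (profile-count col a zero c)
profile-count (c₂ ∷ col) a b zero =
  trans (count-without-first (hasProfile (c₂ ∷ col) a b zero) (λ e → trans (cong ((meet c₀ col e ≡ᵇ a) ∧_) (∧-zeroʳ (meet c₁ col e ≡ᵇ b)))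
                                            (∧-zeroʳ _)))
        (profile-count col a b zero)
profile-count {suc n} (c₀ ∷ col) (suc a) b c = begin
  count (hasProfile (c₀ ∷ col) (suc a) b c) (allSubsets (suc n))
    ≡⟨ count-allSubsets-suc (hasProfile (c₀ ∷ col) (suc a) b c) ⟩
  count (hasProfile col a b c) (allSubsets n) + count (hasProfile col (suc a) b c) (allSubsets n)
    ≡⟨ cong₂ _+_ (profile-count col a b c) (profile-count col (suc a) b c) ⟩
  (x C a) * Y * Z + (x C suc a) * Y * Z
    ≡⟨ pascal-first (x C a) (x C suc a) Y Z ⟩
  ((x C a) + (x C suc a)) * Y * Z
    ≡⟨ cong (λ t → t * Y * Z) (nCk+nC[k+1]≡[n+1]C[k+1] x a) ⟩
  (suc x C suc a) * Y * Z ∎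
  where
  open ≡-Reasoning
  x = classSize c₀ col
  Y = classSize c₁ col C b
  Z = classSize c₂ col C c
  pascal-first : ∀ p p′ q r → p * q * r + p′ * q * r ≡ (p + p′) * q * r
  pascal-first = solve-∀
profile-count {suc n} (c₁ ∷ col) a (suc b) c = begin
  count (hasProfile (c₁ ∷ col) a (suc b) c) (allSubsets (suc n))
    ≡⟨ count-allSubsets-suc (hasProfile (c₁ ∷ col) a (suc b) c) ⟩
  count (hasProfile col a b c) (allSubsets n) + count (hasProfile col a (suc b) c) (allSubsets n)
    ≡⟨ cong₂ _+_ (profile-count col a b c) (profile-count col a (suc b) c) ⟩
  X * (y C b) * Z + X * (y C suc b) * Z
    ≡⟨ pascal-second X (y C b) (y C suc b) Z ⟩
  X * ((y C b) + (y C suc b)) * Z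
    ≡⟨ cong (λ t → X * t * Z) (nCk+nC[k+1]≡[n+1]C[k+1] y b) ⟩
  X * (suc y C suc b) * Z ∎
  where
  open ≡-Reasoning
  X = classSize c₀ col C a
  y = classSize c₁ col
  Z = classSize c₂ col C c
  pascal-second : ∀ p q q′ r → p * q * r + p * q′ * r ≡ p * (q + q′) * r
  pascal-second = solve-∀
profile-count {suc n} (c₂ ∷ col) a b (suc c) = begin
  count (hasProfile (c₂ ∷ col) a b (suc c)) (allSubsets (suc n))
    ≡⟨ count-allSubsets-suc (hasProfile (c₂ ∷ col) a b (suc c)) ⟩
  count (hasProfile col a b c) (allSubsets n) + count (hasProfile col a b (suc c)) (allSubsets n)
    ≡⟨ cong₂ _+_ (profile-count col a b c) (profile-count col a b (suc c)) ⟩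
  X * Y * (z C c) + X * Y * (z C suc c)
    ≡⟨ sym (*-distribˡ-+ (X * Y) (z C c) (z C suc c)) ⟩
  X * Y * ((z C c) + (z C suc c))
    ≡⟨ cong (X * Y *_) (nCk+nC[k+1]≡[n+1]C[k+1] z c) ⟩
  X * Y * (suc z C suc c) ∎
  where
  open ≡-Reasoning
  X = classSize c₀ col C a
  Y = classSize c₁ col C b
  z = classSize c₂ col

inOut : Bool → Colour
inOut true = c₁
inOut false = c₂

colouring : ∀ {n} → Fin n → Subset n → Vec Colour n
colouring zero (_ ∷ S) = c₀ ∷ vmap inOut S
colouring (suc v) (x ∷ S) = inOut x ∷ colouring v S

private
  c₀-absent : ∀ {n} (S : Subset n) → classSize c₀ (vmap inOut S) ≡ 0
  c₀-absent [] = refl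
  c₀-absent (true ∷ S) = c₀-absent S
  c₀-absent (false ∷ S) = c₀-absent S

  c₁-size : ∀ {n} (S : Subset n) → classSize c₁ (vmap inOut S) ≡ ∣ S ∣
  c₁-size [] = refl
  c₁-size (true ∷ S) = cong suc (c₁-size S)
  c₁-size (false ∷ S) = c₁-size S

  c₂-size : ∀ {n} (S : Subset n) → classSize c₂ (vmap inOut S) + ∣ S ∣ ≡ n
  c₂-size [] = refl
  c₂-size (true ∷ S) = trans (+-suc _ _) (cong suc (c₂-size S))
  c₂-size (false ∷ S) = cong suc (c₂-size S)

  c₀-unmet : ∀ {n} (S e : Subset n) → meet c₀ (vmap inOut S) e ≡ 0
  c₀-unmet [] [] = refl
  c₀-unmet (true ∷ S) (true ∷ e) = c₀-unmet S e
  c₀-unmet (false ∷ S) (true ∷ e) = c₀-unmet S e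
  c₀-unmet (_ ∷ S) (false ∷ e) = c₀-unmet S e

  c₂-unmet : ∀ {n} (S e : Subset n) → meet c₂ (vmap inOut S) e ≡ 0 → (e ⊆ᵇ S) ≡ true
  c₂-unmet [] [] _ = refl
  c₂-unmet (true ∷ S) (true ∷ e) unmet = c₂-unmet S e unmet
  c₂-unmet (true ∷ S) (false ∷ e) unmet = c₂-unmet S e unmet
  c₂-unmet (false ∷ S) (false ∷ e) unmet = c₂-unmet S e unmet

centre-class : ∀ {n} (v : Fin n) (S : Subset n) → classSize c₀ (colouring v S) ≡ 1
centre-class zero (_ ∷ S) = cong suc (c₀-absent S)
centre-class (suc v) (true ∷ S) = centre-class v S
centre-class (suc v) (false ∷ S) = centre-class v S

inner-class : ∀ {n} (v : Fin n) (S : Subset n) → lookup S v ≡ true →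
  classSize c₁ (colouring v S) + 1 ≡ ∣ S ∣
inner-class zero (true ∷ S) _ = trans (+-comm _ 1) (cong suc (c₁-size S))
inner-class (suc v) (true ∷ S) Sv = cong suc (inner-class v S Sv)
inner-class (suc v) (false ∷ S) Sv = inner-class v S Sv

outer-class : ∀ {n} (v : Fin n) (S : Subset n) → lookup S v ≡ true →
  classSize c₂ (colouring v S) + ∣ S ∣ ≡ n
outer-class zero (true ∷ S) _ = trans (+-suc _ _) (cong suc (c₂-size S))
outer-class (suc v) (true ∷ S) Sv = trans (+-suc _ _) (cong suc (outer-class v S Sv))
outer-class (suc v) (false ∷ S) Sv = cong suc (outer-class v S Sv)

meet-centre : ∀ {n} (v : Fin n) (S e : Subset n) → lookup e v ≡ true →
  meet c₀ (colouring v S) e ≡ 1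
meet-centre zero (_ ∷ S) (true ∷ e) _ = cong suc (c₀-unmet S e)
meet-centre (suc v) (true ∷ S) (true ∷ e) ev = meet-centre v S e ev
meet-centre (suc v) (false ∷ S) (true ∷ e) ev = meet-centre v S e ev
meet-centre (suc v) (_ ∷ S) (false ∷ e) ev = meet-centre v S e ev

outer-unmet : ∀ {n} (v : Fin n) (S e : Subset n) → lookup S v ≡ true →
  meet c₂ (colouring v S) e ≡ 0 → (e ⊆ᵇ S) ≡ true
outer-unmet zero (true ∷ S) (true ∷ e) _ unmet = c₂-unmet S e unmet
outer-unmet zero (true ∷ S) (false ∷ e) _ unmet = c₂-unmet S e unmet
outer-unmet (suc v) (true ∷ S) (true ∷ e) Sv unmet = outer-unmet v S e Sv unmet
outer-unmet (suc v) (true ∷ S) (false ∷ e) Sv unmet = outer-unmet v S e Sv unmet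
outer-unmet (suc v) (false ∷ S) (false ∷ e) Sv unmet = outer-unmet v S e Sv unmet

edgeIn : ∀ {n} → ThreeGraph n → Subset n → Subset n → Bool
edgeIn H S e = edge H e ∧ (e ⊆ᵇ S)

degreeIn : ∀ {n} → ThreeGraph n → Subset n → Fin n → ℕ
degreeIn H S v = count (λ e → edgeIn H S e ∧ lookup e v) (allSubsets _)

crossing-profile : ∀ x y z → x ≡ 1 → x + y + z ≡ 3 → z ≢ 0 →
  (((x ≡ᵇ 1) ∧ ((y ≡ᵇ 1) ∧ (z ≡ᵇ 1))) ∨ ((x ≡ᵇ 1) ∧ ((y ≡ᵇ 0) ∧ (z ≡ᵇ 2)))) ≡ true
crossing-profile .1 0 2 refl _ _ = refl
crossing-profile .1 1 1 refl _ _ = refl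
crossing-profile .1 2 0 refl _ z≢0 = ⊥-elim (z≢0 refl)
crossing-profile .1 0 0 refl () _
crossing-profile .1 0 1 refl () _
crossing-profile .1 0 (suc (suc (suc _))) refl () _
crossing-profile .1 1 0 refl () _
crossing-profile .1 1 (suc (suc _)) refl () _
crossing-profile .1 2 (suc _) refl () _
crossing-profile .1 (suc (suc (suc _))) _ refl () _

-- Every edge through v ∈ S lies inside S, or has one or two vertices
-- outside S; with a = |S| - 1 and r = n - |S| there are a·r + C(r,2) of
-- the latter kind.
degree-split : ∀ {n} (H : ThreeGraph n) (S : Subset n) (v : Fin n) → lookup S v ≡ true →
  let a = classSize c₁ (colouring v S); r = classSize c₂ (colouring v S) in
  degree H v ≤ degreeIn H S v + (a * r + (r C 2))
degree-split {n} H S v Sv = begin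
  degree H v
    ≡⟨ length-filterᵇ (λ e → edge H e ∧ lookup e v) L ⟩
  count (λ e → edge H e ∧ lookup e v) L
    ≤⟨ count-∨ _ (λ e → edgeIn H S e ∧ lookup e v) crossing classify L ⟩
  degreeIn H S v + count crossing L
    ≤⟨ +-monoʳ-≤ (degreeIn H S v) (count-∨ _ (hasProfile col 1 1 1) (hasProfile col 1 0 2) (λ _ p → p) L) ⟩
  degreeIn H S v + (count (hasProfile col 1 1 1) L + count (hasProfile col 1 0 2) L)
    ≡⟨ cong (degreeIn H S v +_) (cong₂ _+_ (profile-count col 1 1 1) (profile-count col 1 0 2)) ⟩
  degreeIn H S v + ((c C 1) * (a C 1) * (r C 1) + (c C 1) * (a C 0) * (r C 2))
    ≡⟨ cong (λ t → degreeIn H S v + ((t C 1) * (a C 1) * (r C 1) + (t C 1) * 1 * (r C 2))) (centre-class v S) ⟩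
  degreeIn H S v + (1 * (a C 1) * (r C 1) + 1 * 1 * (r C 2))
    ≡⟨ cong (degreeIn H S v +_) (cong₂ (λ p q → 1 * p * q + 1 * 1 * (r C 2)) (nC1≡n a) (nC1≡n r)) ⟩
  degreeIn H S v + (1 * a * r + 1 * 1 * (r C 2))
    ≡⟨ cong (degreeIn H S v +_) (cong₂ _+_ (cong (_* r) (*-identityˡ a)) (*-identityˡ (r C 2))) ⟩
  degreeIn H S v + (a * r + (r C 2)) ∎
  where
  open ≤-Reasoning
  L = allSubsets n
  col = colouring v S
  c = classSize c₀ col
  a = classSize c₁ col
  r = classSize c₂ col
  crossing : Subset n → Bool
  crossing e = hasProfile col 1 1 1 e ∨ hasProfile col 1 0 2 e
  classify : ∀ e → (edge H e ∧ lookup e v) ≡ true →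
    ((edgeIn H S e ∧ lookup e v) ∨ crossing e) ≡ true
  classify e edge-through-v with edge H e in is-edge | lookup e v in ev | e ⊆ᵇ S in e⊆S
  ... | true | true | true = refl
  ... | true | true | false =
    crossing-profile (meet c₀ col e) (meet c₁ col e) (meet c₂ col e) (meet-centre v S e ev)
      (trans (meet-total col e) (uniform H e is-edge))
      (λ unmet → contradiction (trans (sym e⊆S) (outer-unmet v S e Sv unmet)) λ ())

C2-split : ∀ a r → ((a + r) C 2) ≡ (a C 2) + (a * r + (r C 2))
C2-split a zero = begin
  ((a + 0) C 2)                    ≡⟨ cong (_C 2) (+-identityʳ a) ⟩
  (a C 2)                          ≡⟨ sym (+-identityʳ (a C 2)) ⟩
  (a C 2) + 0                      ≡⟨ cong (λ t → (a C 2) + (t + 0)) (sym (*-zeroʳ a)) ⟩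
  (a C 2) + (a * 0 + (0 C 2))      ∎
  where open ≡-Reasoning
C2-split a (suc r) = begin
  ((a + suc r) C 2)                              ≡⟨ cong (_C 2) (+-suc a r) ⟩
  (suc (a + r) C 2)                              ≡⟨ sym (nCk+nC[k+1]≡[n+1]C[k+1] (a + r) 1) ⟩
  ((a + r) C 1) + ((a + r) C 2)                  ≡⟨ cong₂ _+_ (nC1≡n (a + r)) (C2-split a r) ⟩
  (a + r) + ((a C 2) + (a * r + (r C 2)))        ≡⟨ regroup a r (a C 2) (r C 2) ⟩
  (a C 2) + (a * suc r + (r + (r C 2)))          ≡⟨ cong (λ t → (a C 2) + (a * suc r + (t + (r C 2)))) (sym (nC1≡n r)) ⟩
  (a C 2) + (a * suc r + ((r C 1) + (r C 2)))    ≡⟨ cong (λ t → (a C 2) + (a * suc r + t)) (nCk+nC[k+1]≡[n+1]C[k+1] r 1) ⟩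
  (a C 2) + (a * suc r + (suc r C 2))            ∎
  where
  open ≡-Reasoning
  regroup : ∀ a r x y → (a + r) + (x + (a * r + y)) ≡ x + (a * suc r + (r + y))
  regroup = solve-∀

-- The degree of v ∈ S exceeds C(n-1,2) - C(|S|-1,2) by at most its degree in H[S]:
-- only the pairs inside S∖{v} can fail to span edges with v.
link-bound : ∀ {n} (H : ThreeGraph n) (S : Subset n) (v : Fin n) (a : ℕ) →
  lookup S v ≡ true → ∣ S ∣ ≡ suc a →
  degree H v + (a C 2) ≤ ((n ∸ 1) C 2) + degreeIn H S v
link-bound {n} H S v a Sv |S|≡1+a = begin
  degree H v + (a C 2)
    ≤⟨ +-monoˡ-≤ (a C 2) (subst (λ t → degree H v ≤ d + (t * r + (r C 2))) a′≡a (degree-split H S v Sv)) ⟩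
  d + (a * r + (r C 2)) + (a C 2)
    ≡⟨ regroup d (a * r) (r C 2) (a C 2) ⟩
  (a C 2) + (a * r + (r C 2)) + d
    ≡⟨ cong (_+ d) (sym (C2-split a r)) ⟩
  ((a + r) C 2) + d
    ≡⟨ cong (λ t → (t C 2) + d) (sym n-1≡a+r) ⟩
  ((n ∸ 1) C 2) + d ∎
  where
  open ≤-Reasoning
  d = degreeIn H S v
  r = classSize c₂ (colouring v S)
  a′≡a : classSize c₁ (colouring v S) ≡ a
  a′≡a = +-cancelʳ-≡ 1 _ a (trans (inner-class v S Sv) (trans |S|≡1+a (+-comm 1 a)))
  n-1≡a+r : n ∸ 1 ≡ a + r
  n-1≡a+r = cong (_∸ 1) (begin-equality
    n             ≡⟨ sym (outer-class v S Sv) ⟩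
    r + ∣ S ∣     ≡⟨ cong (r +_) |S|≡1+a ⟩
    r + suc a     ≡⟨ +-suc r a ⟩
    suc (r + a)   ≡⟨ cong suc (+-comm r a) ⟩
    suc (a + r)   ∎)
  regroup : ∀ d m y x → d + (m + y) + x ≡ x + (m + y) + d
  regroup = solve-∀

is-edge : ∀ {n} (H : ThreeGraph n) (S e : Subset n) → edgeIn H S e ≡ true → IsEdge H e
is-edge H S e = ∧-conicalˡ (edge H e) (e ⊆ᵇ S)

is-inside : ∀ {n} (H : ThreeGraph n) (S e : Subset n) → edgeIn H S e ≡ true → (e ⊆ᵇ S) ≡ true
is-inside H S e = ∧-conicalʳ (edge H e) (e ⊆ᵇ S)

-- The heart of C₄³-freeness: two edges of H[S] through two distinct
-- vertices v, u of S coincide, since otherwise their third vertices c ≠ d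
-- give the copy {v,u,c}, {v,u,d} of C₄³.
edge-through-pair-unique : ∀ {n} (H : ThreeGraph n) (S : Subset n) → ¬ HasC43In H S →
  ∀ {v u} → lookup S v ≡ true → lookup S u ≡ true → (u == v) ≡ false →
  ∀ e₁ e₂ → edgeIn H S e₁ ≡ true → edgeIn H S e₂ ≡ true →
  lookup e₁ v ≡ true → lookup e₁ u ≡ true → lookup e₂ v ≡ true → lookup e₂ u ≡ true →
  e₁ ≡ e₂
edge-through-pair-unique H S C43-free {v} {u} Sv Su u≠v e₁ e₂ in₁ in₂ e₁v e₁u e₂v e₂u
  with third-vertex e₁ (uniform H e₁ (is-edge H S e₁ in₁)) e₁v e₁u u≠v
     | third-vertex e₂ (uniform H e₂ (is-edge H S e₂ in₂)) e₂v e₂u u≠v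
... | c , e₁c , c≠v , c≠u , e₁≡vuc | d , e₂d , d≠v , d≠u , e₂≡vud with c == d in c=d
...   | true = trans e₁≡vuc (trans (cong (triple v u) (==⇒≡ c=d)) (sym e₂≡vud))
...   | false = ⊥-elim (C43-free (v , u , c , d , members , distinct , edge-vuc , edge-vud))
  where
  ∈S : ∀ {e x} → edgeIn H S e ≡ true → lookup e x ≡ true → x ∈ S
  ∈S {e} {x} in-S ex = lookup⇒[]= x S (⊆ᵇ-lookup e S (is-inside H S e in-S) x ex)
  members = lookup⇒[]= v S Sv , lookup⇒[]= u S Su , ∈S in₁ e₁c , ∈S in₂ e₂d
  distinct = ≢-sym (==-false⇒≢ u≠v) , ≢-sym (==-false⇒≢ c≠v) , ≢-sym (==-false⇒≢ d≠v)
           , ≢-sym (==-false⇒≢ c≠u) , ≢-sym (==-false⇒≢ d≠u) , ==-false⇒≢ c=d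
  edge-vuc : IsEdge H (triple v u c)
  edge-vuc = subst (IsEdge H) e₁≡vuc (is-edge H S e₁ in₁)
  edge-vud : IsEdge H (triple v u d)
  edge-vud = subst (IsEdge H) e₂≡vud (is-edge H S e₂ in₂)

-- In a C₄³-free H[S] the link of v in H[S] is a matching on S∖{v}, hence
-- 2·deg_S(v) + 1 ≤ |S|.  Double count the pairs (u, e) with u ∈ S∖{v}
-- and e an edge of H[S] through v and u: each e gives two such u, and
-- each u lies in at most one such e.
matching-bound : ∀ {n} (H : ThreeGraph n) (S : Subset n) → ¬ HasC43In H S →
  ∀ v → lookup S v ≡ true → 2 * degreeIn H S v + 1 ≤ ∣ S ∣
matching-bound {n} H S C43-free v Sv = begin
  2 * d + 1
    ≡⟨ cong (_+ 1) (*-comm 2 d) ⟩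
  d * 2 + 1
    ≡⟨ cong (_+ 1) (sym (double-count n through-v pairs-with 2 two-partners L)) ⟩
  ∑ n (λ u → count (λ e → through-v e ∧ pairs-with u e) L) + 1
    ≤⟨ +-monoˡ-≤ 1 (∑-mono n at-most-one) ⟩
  ∑ n (λ u → ⟦ other u ⟧) + 1
    ≡⟨ ∑-remove-point (lookup S) v Sv ⟩
  ∑ n (λ u → ⟦ lookup S u ⟧)
    ≡⟨ sym (size-as-sum S) ⟩
  ∣ S ∣ ∎
  where
  open ≤-Reasoning
  L = allSubsets n
  d = degreeIn H S v

  through-v : Subset n → Bool
  through-v e = edgeIn H S e ∧ lookup e v

  other : Fin n → Bool
  other u = lookup S u ∧ not (u == v)

  pairs-with : Fin n → Subset n → Bool
  pairs-with u e = lookup e u ∧ other u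

  two-partners : ∀ e → through-v e ≡ true → ∑ n (λ u → ⟦ pairs-with u e ⟧) ≡ 2
  two-partners e through = +-cancelʳ-≡ 1 _ 2 (begin-equality
    ∑ n (λ u → ⟦ pairs-with u e ⟧) + 1
      ≡⟨ cong (_+ 1) (∑-cong n (λ u → cong ⟦_⟧ (absorb (lookup e u) (lookup S u) _ (⊆ᵇ-lookup e S e⊆S u)))) ⟩
    ∑ n (λ u → ⟦ lookup e u ∧ not (u == v) ⟧) + 1
      ≡⟨ ∑-remove-point (lookup e) v (∧-conicalʳ _ _ through) ⟩
    ∑ n (λ u → ⟦ lookup e u ⟧)
      ≡⟨ sym (size-as-sum e) ⟩
    ∣ e ∣
      ≡⟨ uniform H e (is-edge H S e (∧-conicalˡ _ _ through)) ⟩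
    3 ∎)
    where
    e⊆S = is-inside H S e (∧-conicalˡ _ _ through)
    absorb : ∀ x s y → (x ≡ true → s ≡ true) → (x ∧ (s ∧ y)) ≡ (x ∧ y)
    absorb false s y _ = refl
    absorb true s y x⇒s rewrite x⇒s refl = refl

  at-most-one : ∀ u → count (λ e → through-v e ∧ pairs-with u e) L ≤ ⟦ other u ⟧
  at-most-one u = by-membership (other u) refl
    where
    by-membership : ∀ b → other u ≡ b → count (λ e → through-v e ∧ pairs-with u e) L ≤ ⟦ b ⟧
    by-membership true other-u = count-at-most-one n _ unique
      where
      unique : ∀ e₁ e₂ → (through-v e₁ ∧ pairs-with u e₁) ≡ true →
        (through-v e₂ ∧ pairs-with u e₂) ≡ true → e₁ ≡ e₂
      unique e₁ e₂ p₁ p₂ =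
        let (in₁ , e₁v , e₁u) = parts p₁ ; (in₂ , e₂v , e₂u) = parts p₂
        in edge-through-pair-unique H S C43-free Sv (∧-conicalˡ _ _ other-u)
             (not-injective (∧-conicalʳ (lookup S u) _ other-u)) e₁ e₂ in₁ in₂ e₁v e₁u e₂v e₂u
        where
        parts : ∀ {e} → (through-v e ∧ pairs-with u e) ≡ true →
          edgeIn H S e ≡ true × lookup e v ≡ true × lookup e u ≡ true
        parts {e} p = ∧-conicalˡ _ _ (∧-conicalˡ _ _ p) , ∧-conicalʳ (edgeIn H S e) _ (∧-conicalˡ _ _ p)
                    , ∧-conicalˡ _ _ (∧-conicalʳ (through-v e) _ p)
    by-membership false other-u = ≤-reflexive (count-none _ none L)
      where
      none : ∀ e → (through-v e ∧ pairs-with u e) ≡ false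
      none e = trans (cong (λ b → through-v e ∧ (lookup e u ∧ b)) other-u)
                     (trans (cong (through-v e ∧_) (∧-zeroʳ (lookup e u))) (∧-zeroʳ (through-v e)))

edgesIn : ∀ {n} → ThreeGraph n → Subset n → ℕ
edgesIn H S = count (edgeIn H S) (allSubsets _)

handshake : ∀ {n} (H : ThreeGraph n) (S : Subset n) → ∑ n (degreeIn H S) ≡ edgesIn H S * 3
handshake {n} H S = double-count n (edgeIn H S) (λ v e → lookup e v) 3 three-vertices (allSubsets n)
  where
  three-vertices : ∀ e → edgeIn H S e ≡ true → ∑ n (λ v → ⟦ lookup e v ⟧) ≡ 3
  three-vertices e in-S = trans (sym (size-as-sum e)) (uniform H e (is-edge H S e in-S))

degreeIn-outside : ∀ {n} (H : ThreeGraph n) (S : Subset n) (v : Fin n) →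
  lookup S v ≡ false → degreeIn H S v ≡ 0
degreeIn-outside {n} H S v Sv = count-none _ avoids (allSubsets n)
  where
  avoids : ∀ e → (edgeIn H S e ∧ lookup e v) ≡ false
  avoids e with edgeIn H S e in in-S | lookup e v in ev
  ... | false | _ = refl
  ... | true | false = refl
  ... | true | true with trans (sym Sv) (⊆ᵇ-lookup e S (is-inside H S e in-S) v ev)
  ... | ()

regular-handshake : ∀ {n} (H : ThreeGraph n) (S : Subset n) (d : ℕ) →
  (∀ v → lookup S v ≡ true → degreeIn H S v ≡ d) → edgesIn H S * 3 ≡ d * ∣ S ∣
regular-handshake {n} H S d regular = begin
  edgesIn H S * 3                      ≡⟨ sym (handshake H S) ⟩
  ∑ n (degreeIn H S)                   ≡⟨ ∑-cong n (λ v → by-membership v (lookup S v) refl) ⟩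
  ∑ n (λ v → d * ⟦ lookup S v ⟧)       ≡⟨ ∑-*ˡ n d (λ v → ⟦ lookup S v ⟧) ⟩
  d * ∑ n (λ v → ⟦ lookup S v ⟧)       ≡⟨ cong (d *_) (sym (size-as-sum S)) ⟩
  d * ∣ S ∣                            ∎
  where
  open ≡-Reasoning
  by-membership : ∀ v b → lookup S v ≡ b → degreeIn H S v ≡ d * ⟦ b ⟧
  by-membership v true Sv = trans (regular v Sv) (sym (*-identityʳ d))
  by-membership v false Sv = trans (degreeIn-outside H S v Sv) (sym (*-zeroʳ d))

C2-square : ∀ x → 2 * (x C 2) + x ≡ x * x
C2-square zero = refl
C2-square (suc x) = begin
  2 * (suc x C 2) + suc x              ≡⟨ cong (λ t → 2 * t + suc x) (sym (nCk+nC[k+1]≡[n+1]C[k+1] x 1)) ⟩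
  2 * ((x C 1) + (x C 2)) + suc x      ≡⟨ cong (λ t → 2 * (t + (x C 2)) + suc x) (nC1≡n x) ⟩
  2 * (x + (x C 2)) + suc x            ≡⟨ regroup x (x C 2) ⟩
  (2 * (x C 2) + x) + 2 * x + 1        ≡⟨ cong (λ t → t + 2 * x + 1) (C2-square x) ⟩
  x * x + 2 * x + 1                    ≡⟨ square-suc x ⟩
  suc x * suc x                        ∎
  where
  open ≡-Reasoning
  regroup : ∀ x p → 2 * (x + p) + suc x ≡ (2 * p + x) + 2 * x + 1
  regroup = solve-∀
  square-suc : ∀ x → x * x + 2 * x + 1 ≡ suc x * suc x
  square-suc = solve-∀

-- Trading the degree of v for its degree in H[S]: a lower bound on the
-- degree together with the link bound gives a bound on C(a,2).
degree-deficit : ∀ {P A D d x y} → D + A ≤ P + d → 2 * P + x ≤ 2 * D + y → 2 * A + x ≤ 2 * d + y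
degree-deficit {P} {A} {D} {d} {x} {y} link lower = +-cancelˡ-≤ (2 * P) _ _ (begin
  2 * P + (2 * A + x)        ≡⟨ regroup-left P A x ⟩
  (2 * P + x) + 2 * A        ≤⟨ +-monoˡ-≤ (2 * A) lower ⟩
  (2 * D + y) + 2 * A        ≡⟨ regroup-middle D y A ⟩
  2 * (D + A) + y            ≤⟨ +-monoˡ-≤ y (*-monoʳ-≤ 2 link) ⟩
  2 * (P + d) + y            ≡⟨ regroup-right P d y ⟩
  2 * P + (2 * d + y)        ∎)
  where
  open ≤-Reasoning
  regroup-left : ∀ P A x → 2 * P + (2 * A + x) ≡ (2 * P + x) + 2 * A
  regroup-left = solve-∀
  regroup-middle : ∀ D y A → (2 * D + y) + 2 * A ≡ 2 * (D + A) + y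
  regroup-middle = solve-∀
  regroup-right : ∀ P d y → 2 * (P + d) + y ≡ 2 * P + (2 * d + y)
  regroup-right = solve-∀

clear-binomials : ∀ {a d K x y} → 2 * d ≤ a →
  2 * (a C 2) + x ≤ 2 * d + (2 * (K C 2) + y) → a * a + (K + x) ≤ 2 * a + (K * K + y)
clear-binomials {a} {d} {K} {x} {y} 2d≤a bound = begin
  a * a + (K + x)                      ≡⟨ cong (_+ (K + x)) (sym (C2-square a)) ⟩
  (2 * (a C 2) + a) + (K + x)          ≡⟨ regroup-left (2 * (a C 2)) a K x ⟩
  (2 * (a C 2) + x) + (a + K)          ≤⟨ +-monoˡ-≤ (a + K) bound ⟩
  (2 * d + (2 * (K C 2) + y)) + (a + K)  ≤⟨ +-monoˡ-≤ (a + K) (+-monoˡ-≤ _ 2d≤a) ⟩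
  (a + (2 * (K C 2) + y)) + (a + K)    ≡⟨ regroup-right a (2 * (K C 2)) y K ⟩
  2 * a + ((2 * (K C 2) + K) + y)      ≡⟨ cong (λ t → 2 * a + (t + y)) (C2-square K) ⟩
  2 * a + (K * K + y)                  ∎
  where
  open ≤-Reasoning
  regroup-left : ∀ p a K x → (p + a) + (K + x) ≡ (p + x) + (a + K)
  regroup-left = solve-∀
  regroup-right : ∀ a q y K → (a + (q + y)) + (a + K) ≡ 2 * a + ((q + K) + y)
  regroup-right = solve-∀

-- For a ≥ K the inequality a² + 2K + 2 ≤ 2a + K² is impossible:
-- with a = K + t the difference is 2Kt + (t - 1)² + 1 > 0.
even-impossible : ∀ {a d K} → K ≤ a → 2 * d ≤ a →
  ¬ (2 * (a C 2) + (K + 2) ≤ 2 * d + 2 * (K C 2))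
even-impossible {a} {d} {K} K≤a 2d≤a bound
  with m≤n⇒∃[o]m+o≡n K≤a
     | clear-binomials {a} {d} {K} {K + 2} {0} 2d≤a
         (subst (2 * (a C 2) + (K + 2) ≤_) (cong (2 * d +_) (sym (+-identityʳ _))) bound)
... | t , refl | squares = excess K t squares
  where
  excess : ∀ K t → ¬ ((K + t) * (K + t) + (K + (K + 2)) ≤ 2 * (K + t) + (K * K + 0))
  excess K zero = m+n≮n 1 _ ∘ subst (_≤ 2 * (K + 0) + (K * K + 0)) (expand K)
    where
    expand : ∀ K → (K + 0) * (K + 0) + (K + (K + 2)) ≡ suc (1 + (2 * (K + 0) + (K * K + 0)))
    expand = solve-∀
  excess K (suc u) = m+n≮n (2 * K * suc u + u * u) _ ∘ subst (_≤ 2 * (K + suc u) + (K * K + 0)) (expand K u)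
    where
    expand : ∀ K u → (K + suc u) * (K + suc u) + (K + (K + 2))
      ≡ suc ((2 * K * suc u + u * u) + (2 * (K + suc u) + (K * K + 0)))
    expand = solve-∀

odd-tight : ∀ {a d} m → 2 * suc m + 1 ≤ a → 2 * d ≤ a →
  2 * (a C 2) + (2 * suc m + 1) ≤ 2 * d + (2 * ((2 * suc m + 1) C 2) + 1) →
  a ≡ 2 * suc m + 1 × d ≡ suc m
odd-tight {a} {d} m K≤a 2d≤a bound with m≤n⇒∃[o]m+o≡n K≤a
... | suc u , refl = ⊥-elim (m+n≮n (4 * m * suc u + 6 * u + 3 + u * u) _
        (subst (_≤ 2 * (K + suc u) + (K * K + 1)) (expand m u) (clear-binomials {d = d} {K = K} 2d≤a bound)))
  where
  K = 2 * suc m + 1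
  expand : ∀ m u → let K = 2 * suc m + 1 in (K + suc u) * (K + suc u) + (K + K)
    ≡ suc ((4 * m * suc u + 6 * u + 3 + u * u) + (2 * (K + suc u) + (K * K + 1)))
  expand = solve-∀
... | zero , refl = +-identityʳ K , ≤-antisym d≤1+m 1+m≤d
  where
  K = 2 * suc m + 1
  K≤2d+1 : K ≤ 2 * d + 1
  K≤2d+1 = +-cancelˡ-≤ (2 * (K C 2)) _ _ (begin
    2 * (K C 2) + K                ≡⟨ cong (λ t → 2 * (t C 2) + K) (sym (+-identityʳ K)) ⟩
    2 * ((K + 0) C 2) + K          ≤⟨ bound ⟩
    2 * d + (2 * (K C 2) + 1)      ≡⟨ regroup d (K C 2) ⟩
    2 * (K C 2) + (2 * d + 1)      ∎)
    where
    open ≤-Reasoning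
    regroup : ∀ d c → 2 * d + (2 * c + 1) ≡ 2 * c + (2 * d + 1)
    regroup = solve-∀
  1+m≤d : suc m ≤ d
  1+m≤d = *-cancelˡ-≤ 2 (+-cancelʳ-≤ 1 _ _ K≤2d+1)
  d≤1+m : d ≤ suc m
  d≤1+m = m<1+n⇒m≤n (*-cancelˡ-< 2 d (suc (suc m))
            (subst (suc (2 * d) ≤_) (two-more m) (+-monoʳ-≤ 1 (subst (2 * d ≤_) (+-identityʳ K) 2d≤a))))
    where
    two-more : ∀ m → 1 + (2 * suc m + 1) ≡ 2 * suc (suc m)
    two-more = solve-∀

vertex-constraints : ∀ {n} (H : ThreeGraph n) (S : Subset n) → ¬ HasC43In H S →
  ∀ v a {x y} → lookup S v ≡ true → ∣ S ∣ ≡ suc a →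
  2 * ((n ∸ 1) C 2) + x ≤ 2 * degree H v + y →
  2 * (a C 2) + x ≤ 2 * degreeIn H S v + y × 2 * degreeIn H S v ≤ a
vertex-constraints {n} H S C43-free v a Sv |S|≡1+a lower =
  degree-deficit {P = (n ∸ 1) C 2} {A = a C 2} {D = degree H v} {d = degreeIn H S v} (link-bound H S v a Sv |S|≡1+a) lower ,
  +-cancelʳ-≤ 1 _ _ (subst (2 * degreeIn H S v + 1 ≤_) (trans |S|≡1+a (+-comm 1 a))
                           (matching-bound H S C43-free v Sv))

-- Case 8 ∣ n: a single vertex of S already violates the degree bound.
no-large-set-even : ∀ {n} (H : ThreeGraph n) (S : Subset n) → ¬ HasC43In H S →
  ∀ a K → ∣ S ∣ ≡ suc a → K ≤ a →
  (∀ v → 2 * ((n ∸ 1) C 2) + (K + 2) ≤ 2 * degree H v + 2 * (K C 2)) → ⊥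
no-large-set-even H S C43-free a K |S|≡1+a K≤a lower =
  let (v , Sv) = member-of-nonempty S |S|≡1+a
      (bound , 2d≤a) = vertex-constraints H S C43-free v a Sv |S|≡1+a (lower v)
  in even-impossible {d = degreeIn H S v} K≤a 2d≤a bound

-- 3e = (3j+1)(6j+4) is impossible, as the right side is 1 modulo 3.
not-multiple-of-three : ∀ j e → e * 3 ≢ suc (3 * j) * suc (2 * suc (3 * j) + 1)
not-multiple-of-three j e 3e≡ = one-not-divisible (∣m+n∣m⇒∣n 3∣3b+1 (divides b (*-comm 3 b)))
  where
  b = 6 * j * j + 6 * j + 1
  expand : ∀ j → suc (3 * j) * suc (2 * suc (3 * j) + 1) ≡ 3 * (6 * j * j + 6 * j + 1) + 1
  expand = solve-∀
  3∣3b+1 : 3 ∣ 3 * b + 1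
  3∣3b+1 = divides e (sym (trans 3e≡ (expand j)))
  one-not-divisible : ¬ (3 ∣ 1)
  one-not-divisible 3∣1 with ∣⇒≤ 3∣1
  ... | s≤s ()

-- Case 8 ∤ n, K = 3k = 6j + 3: the degree bound forces |S| = K + 1 and
-- every vertex of S to have degree exactly 3j + 1 in H[S]; the handshake
-- lemma then makes 3·e(H[S]) ≡ 1 (mod 3).
no-large-set-odd : ∀ {n} (H : ThreeGraph n) (S : Subset n) → ¬ HasC43In H S →
  ∀ a K j → K ≡ 2 * suc (3 * j) + 1 → ∣ S ∣ ≡ suc a → K ≤ a →
  (∀ v → 2 * ((n ∸ 1) C 2) + K ≤ 2 * degree H v + (2 * (K C 2) + 1)) → ⊥
no-large-set-odd H S C43-free a K j refl |S|≡1+a K≤a lower =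
  not-multiple-of-three j (edgesIn H S) (begin
    edgesIn H S * 3                 ≡⟨ regular-handshake H S (suc (3 * j)) (λ v Sv → proj₂ (tight v Sv)) ⟩
    suc (3 * j) * ∣ S ∣             ≡⟨ cong (λ t → suc (3 * j) * t) |S|≡1+a ⟩
    suc (3 * j) * suc a             ≡⟨ cong (λ t → suc (3 * j) * suc t) (proj₁ (tight v₀ Sv₀)) ⟩
    suc (3 * j) * suc K             ∎)
  where
  open ≡-Reasoning
  tight : ∀ v → lookup S v ≡ true → a ≡ K × degreeIn H S v ≡ suc (3 * j)
  tight v Sv =
    let (bound , 2d≤a) = vertex-constraints H S C43-free v a Sv |S|≡1+a (lower v)
    in odd-tight {d = degreeIn H S v} (3 * j) K≤a 2d≤a bound
  v₀ = proj₁ (member-of-nonempty S |S|≡1+a)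
  Sv₀ = proj₂ (member-of-nonempty S |S|≡1+a)

exceeds-three-quarters : ∀ {n} k {s} → n ≡ 4 * k → ¬ (4 * s ≤ 3 * n) → ∃[ a ] s ≡ suc a × 3 * k ≤ a
exceeds-three-quarters k {s} refl large =
  predecessor (*-cancelˡ-< 4 (3 * k) s (subst (_< 4 * s) (swap k) (≰⇒> large)))
  where
  swap : ∀ k → 3 * (4 * k) ≡ 4 * (3 * k)
  swap = solve-∀
  predecessor : ∀ {K s} → K < s → ∃[ a ] s ≡ suc a × K ≤ a
  predecessor (s≤s K≤a) = _ , refl , K≤a

even-or-odd : ∀ k → ∃[ j ] (k ≡ 2 * j ⊎ k ≡ 2 * j + 1)
even-or-odd zero = 0 , inj₁ refl
even-or-odd (suc k) with even-or-odd k
... | j , inj₁ refl = j , inj₂ (+-comm 1 (2 * j))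
... | j , inj₂ refl = suc j , inj₁ (next j)
  where
  next : ∀ j → suc (2 * j + 1) ≡ 2 * suc j
  next = solve-∀

eight-divides : ∀ {n} k j → n ≡ 4 * k → k ≡ 2 * j → 8 ∣ n
eight-divides _ j refl refl = divides j (eight j)
  where
  eight : ∀ j → 4 * (2 * j) ≡ j * 8
  eight = solve-∀

eight-not-divides : ∀ {n} k j → n ≡ 4 * k → k ≡ 2 * j + 1 → ¬ (8 ∣ n)
eight-not-divides _ j refl refl 8∣n with ∣⇒≤ (∣m+n∣m⇒∣n (subst (8 ∣_) (split j) 8∣n) (divides j (*-comm 8 j)))
  where
  split : ∀ j → 4 * (2 * j + 1) ≡ 8 * j + 4
  split = solve-∀
... | s≤s (s≤s (s≤s (s≤s ())))

fact4p1 : (n k : ℕ) → n ≡ 4 * k → (H : ThreeGraph n) →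
    (8 ∣ n → ∀ (v : Fin n) →
    2 * ((n ∸ 1) C 2) + 3 * k + 2 ≤ 2 * degree H v + 2 * ((3 * k) C 2)) →
    (¬ (8 ∣ n) → ∀ (v : Fin n) →
    2 * ((n ∸ 1) C 2) + 3 * k ≤ 2 * degree H v + 2 * ((3 * k) C 2) + 1) →
    (S : Subset n) → ¬ HasC43In H S → 4 * ∣ S ∣ ≤ 3 * n
fact4p1 n k n≡4k H lower-even lower-odd S C43-free with 4 * ∣ S ∣ ≤? 3 * n
... | yes small = small
... | no large with exceeds-three-quarters k n≡4k large | even-or-odd k
...   | a , |S|≡1+a , 3k≤a | j , inj₁ k≡2j =
  ⊥-elim (no-large-set-even H S C43-free a (3 * k) |S|≡1+a 3k≤a even-bound)
  where
  even-bound : ∀ v → 2 * ((n ∸ 1) C 2) + (3 * k + 2) ≤ 2 * degree H v + 2 * ((3 * k) C 2)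
  even-bound v = ≤-trans (≤-reflexive (sym (+-assoc (2 * ((n ∸ 1) C 2)) (3 * k) 2))) (lower-even (eight-divides k j n≡4k k≡2j) v)
...   | a , |S|≡1+a , 3k≤a | j , inj₂ k≡2j+1 =
  ⊥-elim (no-large-set-odd H S C43-free a (3 * k) j (three-k k≡2j+1) |S|≡1+a 3k≤a odd-bound)
  where
  odd-bound : ∀ v → 2 * ((n ∸ 1) C 2) + 3 * k ≤ 2 * degree H v + (2 * ((3 * k) C 2) + 1)
  odd-bound v = ≤-trans (lower-odd (eight-not-divides k j n≡4k k≡2j+1) v) (≤-reflexive (+-assoc (2 * degree H v) (2 * ((3 * k) C 2)) 1))
  three-k : k ≡ 2 * j + 1 → 3 * k ≡ 2 * suc (3 * j) + 1
  three-k k≡ = trans (cong (3 *_) k≡) (expand j)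
    where
    expand : ∀ j → 3 * (2 * j + 1) ≡ 2 * suc (3 * j) + 1
    expand = solve-∀
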